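{- Let $V=V_1\cup V_2$ with $|V_1|=|V_2|=n$, and consider the weighted correlation clustering instance on the complete graph on $V$ with $\lambda^-_{uv}=1/3$ and $\lambda^+_{uv}=2/3$ for $(u,v)\in V_1\times V_2$, and $\lambda^-_{uv}=2/3$, $\lambda^+_{uv}=1/3$ for all other pairs of distinct vertices. Then the cost of an optimum clustering is at least $n^2-O(n)$.
   Context: Weighted correlation clustering: for every pair of distinct vertices $u,v$ weights $\lambda^+_{uv},\lambda^-_{uv}\ge0$ with $\lambda^+_{uv}+\lambda^-_{uv}=1$; the cost of a partition of $V$ is $\sum_{\{u,v\}}\big(\lambda^+_{uv}\mathbb{1}[u,v\text{ in different parts}]+\lambda^-_{uv}\mathbb{1}[u,v\text{ in the same part}]\big)$. -}

module Defs where

open import Data.Nat as ℕ using (ℕ; zero; suc; _+_; _<ᵇ_)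
open import Data.Fin using (Fin; toℕ) renaming (zero to fz; suc to fs)
open import Data.Bool using (Bool; true; false; if_then_else_; _xor_)
open import Data.Integer using (+_)
open import Data.Rational using (ℚ; _/_; 0ℚ) renaming (_+_ to _+ℚ_; _*_ to _*ℚ_)
open import Relation.Nullary using (does)

-- Vertex set V = V₁ ∪ V₂ with |V₁| = |V₂| = n, encoded as Fin (n + n):
-- vertex i lies in V₁ iff toℕ i < n, otherwise in V₂.
inV₁ : (n : ℕ) → Fin (n + n) → Bool
inV₁ n i = toℕ i <ᵇ n

cross : (n : ℕ) → Fin (n + n) → Fin (n + n) → Bool
cross n u v = inV₁ n u xor inV₁ n v

λ⁺ : (n : ℕ) → Fin (n + n) → Fin (n + n) → ℚ
λ⁺ n u v = if cross n u v then (+ 2) / 3 else (+ 1) / 3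

λ⁻ : (n : ℕ) → Fin (n + n) → Fin (n + n) → ℚ
λ⁻ n u v = if cross n u v then (+ 1) / 3 else (+ 2) / 3

sumFin : (m : ℕ) → (Fin m → ℚ) → ℚ
sumFin zero f = 0ℚ
sumFin (suc m) f = f fz +ℚ sumFin m (λ i → f (fs i))

-- A clustering (partition of V) is given by a labelling c : V → ℕ;
-- the parts are the nonempty fibres, so u, v are in the same part iff c u ≡ c v.
-- Every partition of the finite set V arises this way.
pairCost : (n : ℕ) → (Fin (n + n) → ℕ) → Fin (n + n) → Fin (n + n) → ℚ
pairCost n c u v =
  if does (c u ℕ.≟ c v) then λ⁻ n u v else λ⁺ n u v

cost : (n : ℕ) → (Fin (n + n) → ℕ) → ℚ
cost n c = sumFin (n + n) λ u → sumFin (n + n) λ v →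
  if toℕ u <ᵇ toℕ v then pairCost n c u v else 0ℚ

-- Put σ = +1 on V₁ and σ = −1 on V₂.  Checking all cases, every weight w(u,v) paid by a
-- clustering satisfies 6·w(u,v) = 3 − σᵤσᵥ + 2·[u ∼ v]·σᵤσᵥ, where u ∼ v means "same part".
-- Summed over all ordered pairs, Σ σᵤσᵥ = (Σ σ)² = 0 since |V₁| = |V₂|, while
-- Σ [u ∼ v]·σᵤσᵥ is the sum over the parts of the squared σ-sum of the part, hence ≥ 0.
-- So the ordered-pair sum of the weights is at least N²/2 (N = 2n); the cost counts each unordered
-- pair once and omits the diagonal terms 2/3, so it is at least N²/4 − N/3 = n² − 2n/3.

module Submission where

open import Defs
open import Data.Nat using (ℕ; _≥_)
open import Data.Fin using (Fin)
open import Data.Product using (∃₂)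
open import Data.Integer using (+_)
open import Data.Rational using (ℚ; _≤_; _-_; _*_)
open import Data.Rational using (_/_)

open import Algebra.Bundles using (CommutativeRing)
open import Data.Bool using (Bool; true; false; if_then_else_; _xor_)
open import Data.Bool.Properties using (xor-comm; xor-same)
open import Data.Fin using (toℕ) renaming (zero to fz; suc to fs)
open import Data.Integer as ℤ using (1ℤ)
import Data.Integer.Properties as ℤ
open import Data.Nat as ℕ using (zero; suc; _<_; s≤s; _<ᵇ_; _⊔_)
import Data.Nat.Properties as ℕ
open import Data.Rational using (0ℚ; 1ℚ; _+_; -_; toℚᵘ; nonNegative; nonPositive)
import Data.Rational.Properties as ℚ
open import Data.Rational.Solver using (module +-*-Solver)
open import Data.Rational.Unnormalised using (mkℚᵘ; *≡*) renaming (_+_ to _+ᵘ_)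
import Data.Rational.Unnormalised.Properties as ℚᵘ
open import Data.Product using (_,_)
open import Data.Sum using (inj₁; inj₂)
open import Data.Vec.Functional using (Vector; foldr)
open import Function using (_∘_)
open import Relation.Nullary using (does)
open import Relation.Nullary.Decidable using (dec-true)
open import Relation.Binary.PropositionalEquality

open import Algebra.Properties.Semiring.Sum (CommutativeRing.semiring ℚ.+-*-commutativeRing)
open import Algebra.Properties.Semiring.Mult (CommutativeRing.semiring ℚ.+-*-commutativeRing)
open +-*-Solver

sumFin≡∑ : ∀ m (f : Fin m → ℚ) → sumFin m f ≡ ∑[ i < m ] f i
sumFin≡∑ zero    f = refl
sumFin≡∑ (suc m) f = cong (_+_ (f fz)) (sumFin≡∑ m (f ∘ fs))

∑-nonNeg : ∀ m (f : Fin m → ℚ) → (∀ i → 0ℚ ≤ f i) → 0ℚ ≤ ∑[ i < m ] f i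
∑-nonNeg zero    f f≥0 = ℚ.≤-refl
∑-nonNeg (suc m) f f≥0 = ℚ.+-mono-≤ (f≥0 fz) (∑-nonNeg m (f ∘ fs) (f≥0 ∘ fs))

∑-*-∑ : ∀ m k (x : Fin m → ℚ) (y : Fin k → ℚ) →
        (∑[ u < m ] x u) * (∑[ v < k ] y v) ≡ ∑[ u < m ] ∑[ v < k ] (x u * y v)
∑-*-∑ m k x y = trans (*-distribʳ-sum (sum y) x) (sum-cong-≗ (λ u → *-distribˡ-sum (x u) y))

∑∑ : (m : ℕ) → (Fin m → Fin m → ℚ) → ℚ
∑∑ m h = ∑[ u < m ] ∑[ v < m ] h u v

∑< : (m : ℕ) → (Fin m → Fin m → ℚ) → ℚ
∑< m h = ∑[ u < m ] ∑[ v < m ] (if toℕ u <ᵇ toℕ v then h u v else 0ℚ)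

∑∑-distrib-+ : ∀ m (f g : Fin m → Fin m → ℚ) →
               ∑∑ m (λ u v → f u v + g u v) ≡ ∑∑ m f + ∑∑ m g
∑∑-distrib-+ m f g = trans (sum-cong-≗ (λ u → ∑-distrib-+ (f u) (g u)))
                           (∑-distrib-+ (λ u → sum (f u)) (λ u → sum (g u)))

∑∑-distribˡ-* : ∀ m a (f : Fin m → Fin m → ℚ) → ∑∑ m (λ u v → a * f u v) ≡ a * ∑∑ m f
∑∑-distribˡ-* m a f = sym (trans (*-distribˡ-sum a (λ u → sum (f u)))
                                 (sum-cong-≗ (λ u → *-distribˡ-sum a (f u))))

∑∑-const : ∀ m a → ∑∑ m (λ _ _ → a) ≡ m × (m × a)
∑∑-const m a = trans (sum-cong-≗ {m} (λ _ → sum-replicate m)) (sum-replicate m {m × a})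

∑∑-symmetric-split : ∀ m (h : Fin m → Fin m → ℚ) → (∀ u v → h u v ≡ h v u) →
               ∑∑ m h ≡ (∑< m h + ∑< m h) + ∑[ u < m ] h u u
∑∑-symmetric-split zero    h h-sym = refl
∑∑-symmetric-split (suc m) h h-sym = begin
  ∑∑ (suc m) h
    ≡⟨ cong (_+_ (h₀₀ + row)) (∑-distrib-+ (λ u → h (fs u) fz) (λ u → ∑[ v < m ] h′ u v)) ⟩
  (h₀₀ + row) + (column + ∑∑ m h′)
    ≡⟨ cong₂ (λ r s → (h₀₀ + row) + (r + s)) column≡row
             (∑∑-symmetric-split m h′ (λ u v → h-sym (fs u) (fs v))) ⟩
  (h₀₀ + row) + (row + ((T + T) + diag))
    ≡⟨ solve 4 (λ a r t d → (a :+ r) :+ (r :+ ((t :+ t) :+ d)) := ((r :+ t) :+ (r :+ t)) :+ (a :+ d))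
               refl h₀₀ row T diag ⟩
  ((row + T) + (row + T)) + (h₀₀ + diag)
    ≡⟨ cong (λ t → (t + t) + (h₀₀ + diag)) (sym ∑<-suc) ⟩
  (∑< (suc m) h + ∑< (suc m) h) + ∑[ u < suc m ] h u u ∎
  where
  open ≡-Reasoning
  h′ : Fin m → Fin m → ℚ
  h′ u v = h (fs u) (fs v)
  h₀₀ row column T diag : ℚ
  h₀₀ = h fz fz
  row = ∑[ v < m ] h fz (fs v)
  column = ∑[ u < m ] h (fs u) fz
  T = ∑< m h′
  diag = ∑[ u < m ] h′ u u
  column≡row : column ≡ row
  column≡row = sum-cong-≗ (λ u → h-sym (fs u) fz)
  ∑<-suc : ∑< (suc m) h ≡ row + T
  ∑<-suc = cong₂ _+_ (ℚ.+-identityˡ row)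
    (sum-cong-≗ (λ u → ℚ.+-identityˡ (∑[ v < m ] (if toℕ u <ᵇ toℕ v then h′ u v else 0ℚ))))

square-nonNeg : ∀ p → 0ℚ ≤ p * p
square-nonNeg p with ℚ.≤-total 0ℚ p
... | inj₁ 0≤p = subst (_≤ p * p) (ℚ.*-zeroʳ p) (ℚ.*-monoˡ-≤-nonNeg p {{nonNegative 0≤p}} 0≤p)
... | inj₂ p≤0 = subst (_≤ p * p) (ℚ.*-zeroˡ p) (ℚ.*-monoʳ-≤-nonPos p {{nonPositive p≤0}} p≤0)

∑-indicator : ∀ L a (g : ℕ → ℚ) → a < L →
              ∑[ l < L ] (if does (a ℕ.≟ toℕ l) then g (toℕ l) else 0ℚ) ≡ g a
∑-indicator (suc L) zero    g _         =
  trans (cong (_+_ (g 0)) (sum-replicate-zero L)) (ℚ.+-identityʳ (g 0))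
∑-indicator (suc L) (suc a) g (s≤s a<L) =
  trans (ℚ.+-identityˡ _) (∑-indicator L a (g ∘ suc) a<L)

≤-foldr-⊔ : ∀ {m} (c : Vector ℕ m) i → c i ℕ.≤ foldr _⊔_ 0 c
≤-foldr-⊔ c fz     = ℕ.m≤m⊔n (c fz) _
≤-foldr-⊔ c (fs i) = ℕ.≤-trans (≤-foldr-⊔ (c ∘ fs) i) (ℕ.m≤n⊔m (c fz) _)

if-*-if : ∀ p q a b → (if p then a else 0ℚ) * (if q then b else 0ℚ) ≡
                      (if q then (if p then a * b else 0ℚ) else 0ℚ)
if-*-if true  true  a b = refl
if-*-if true  false a b = ℚ.*-zeroʳ a
if-*-if false true  a b = ℚ.*-zeroˡ b
if-*-if false false a b = refl

sameBlock : ∀ {m} → (Fin m → ℕ) → (Fin m → ℚ) → Fin m → Fin m → ℚ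
sameBlock c x u v = if does (c u ℕ.≟ c v) then x u * x v else 0ℚ

sameBlock-nonNeg : ∀ m (c : Fin m → ℕ) (x : Fin m → ℚ) → 0ℚ ≤ ∑∑ m (sameBlock c x)
sameBlock-nonNeg m c x =
  subst (0ℚ ≤_) ∑blocks² (∑-nonNeg L (λ l → block l * block l) (square-nonNeg ∘ block))
  where
  L : ℕ
  L = suc (foldr _⊔_ 0 c)
  part : Fin m → Fin L → ℚ
  part u l = if does (c u ℕ.≟ toℕ l) then x u else 0ℚ
  block : Fin L → ℚ
  block l = ∑[ u < m ] part u l
  ∑parts : ∀ u v → ∑[ l < L ] (part u l * part v l) ≡ sameBlock c x u v
  ∑parts u v =
    trans (sum-cong-≗ {L} (λ l → if-*-if (does (c u ℕ.≟ toℕ l)) (does (c v ℕ.≟ toℕ l)) (x u) (x v)))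
          (∑-indicator L (c v) (λ t → if does (c u ℕ.≟ t) then x u * x v else 0ℚ) (s≤s (≤-foldr-⊔ c v)))
  ∑blocks² : ∑[ l < L ] (block l * block l) ≡ ∑∑ m (sameBlock c x)
  ∑blocks² = begin
    ∑[ l < L ] (block l * block l)
      ≡⟨ sum-cong-≗ {L} (λ l → ∑-*-∑ m m (λ u → part u l) (λ v → part v l)) ⟩
    ∑[ l < L ] ∑[ u < m ] ∑[ v < m ] (part u l * part v l)
      ≡⟨ ∑-comm (λ l u → ∑[ v < m ] (part u l * part v l)) ⟩
    ∑[ u < m ] ∑[ l < L ] ∑[ v < m ] (part u l * part v l)
      ≡⟨ sum-cong-≗ {m} (λ u → ∑-comm (λ l v → part u l * part v l)) ⟩
    ∑[ u < m ] ∑[ v < m ] ∑[ l < L ] (part u l * part v l)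
      ≡⟨ sum-cong-≗ {m} (λ u → sum-cong-≗ {m} (∑parts u)) ⟩
    ∑∑ m (sameBlock c x) ∎
    where open ≡-Reasoning

sign : Bool → ℚ
sign b = if b then 1ℚ else - 1ℚ

∑-sign : ∀ k m → ∑[ i < k ℕ.+ m ] sign (toℕ i <ᵇ k) ≡ k × 1ℚ - m × 1ℚ
∑-sign zero    zero    = refl
∑-sign zero    (suc m) = trans (cong (_+_ (- 1ℚ)) (∑-sign zero m))
  (solve 1 (λ a → con (- 1ℚ) :+ (con 0ℚ :- a) := con 0ℚ :- (con 1ℚ :+ a)) refl (m × 1ℚ))
∑-sign (suc k) m       = trans (cong (_+_ 1ℚ) (∑-sign k m))
  (solve 2 (λ a b → con 1ℚ :+ (a :- b) := (con 1ℚ :+ a) :- b) refl (k × 1ℚ) (m × 1ℚ))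

×-as-* : ∀ k x → k × x ≡ (k × 1ℚ) * x
×-as-* k x = sym (trans (×-assoc-* k 1ℚ x) (cong (k ×_) (ℚ.*-identityˡ x)))

×1-nonNeg : ∀ k → 0ℚ ≤ k × 1ℚ
×1-nonNeg zero    = ℚ.≤-refl
×1-nonNeg (suc k) = ℚ.+-mono-≤ (ℚ.nonNegative⁻¹ 1ℚ) (×1-nonNeg k)

-- k × 1ℚ is the embedding ℕ → ℚ in which the summation library computes constant sums.
/1≡×1ℚ : ∀ k → + k / 1 ≡ k × 1ℚ
/1≡×1ℚ zero    = refl
/1≡×1ℚ (suc k) = trans /1-suc (cong (_+_ 1ℚ) (/1≡×1ℚ k))
  where
  open ℚᵘ.≃-Reasoning
  /1-suc : + suc k / 1 ≡ 1ℚ + + k / 1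
  /1-suc = ℚ.toℚᵘ-injective (begin
    toℚᵘ (+ suc k / 1)          ≈⟨ ℚ.toℚᵘ-fromℚᵘ (mkℚᵘ (+ suc k) 0) ⟩
    mkℚᵘ (+ suc k) 0            ≈⟨ *≡* (trans (ℤ.*-identityʳ (+ suc k)) (sym one+k)) ⟩
    toℚᵘ 1ℚ +ᵘ mkℚᵘ (+ k) 0     ≈⟨ ℚᵘ.+-congʳ (toℚᵘ 1ℚ) (ℚᵘ.≃-sym (ℚ.toℚᵘ-fromℚᵘ (mkℚᵘ (+ k) 0))) ⟩
    toℚᵘ 1ℚ +ᵘ toℚᵘ (+ k / 1)   ≈⟨ ℚᵘ.≃-sym (ℚ.toℚᵘ-homo-+ 1ℚ (+ k / 1)) ⟩
    toℚᵘ (1ℚ + + k / 1)         ∎)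
    where
    one+k : (1ℤ ℤ.* 1ℤ ℤ.+ + k ℤ.* 1ℤ) ℤ.* 1ℤ ≡ + suc k
    one+k = trans (ℤ.*-identityʳ _) (cong (ℤ._+_ 1ℤ) (ℤ.*-identityʳ (+ k)))

quadratic-bound : ∀ C ν D → 0ℚ ≤ ν → 0ℚ ≤ D →
                  + 6 / 1 * ((C + C) + (ν + ν) * (+ 2 / 3))
                    ≡ (ν + ν) * ((ν + ν) * (+ 3 / 1)) + + 2 / 1 * D →
                  ν * ν - ν ≤ C
quadratic-bound C ν D ν≥0 D≥0 identity = ℚ.*-cancelˡ-≤-pos (+ 12 / 1) (begin
  + 12 / 1 * (ν * ν - ν)                             ≡⟨ ℚ.+-identityʳ _ ⟨
  + 12 / 1 * (ν * ν - ν) + 0ℚ                        ≤⟨ ℚ.+-monoʳ-≤ (+ 12 / 1 * (ν * ν - ν)) slack≥0 ⟩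
  + 12 / 1 * (ν * ν - ν) + (+ 4 / 1 * ν + + 2 / 1 * D)
    ≡⟨ solve 2 (λ ν D → con (+ 12 / 1) :* (ν :* ν :- ν) :+ (con (+ 4 / 1) :* ν :+ con (+ 2 / 1) :* D)
                      := ((ν :+ ν) :* ((ν :+ ν) :* con (+ 3 / 1)) :+ con (+ 2 / 1) :* D) :- con (+ 8 / 1) :* ν)
               refl ν D ⟩
  ((ν + ν) * ((ν + ν) * (+ 3 / 1)) + + 2 / 1 * D) - + 8 / 1 * ν
    ≡⟨ cong (_- + 8 / 1 * ν) identity ⟨
  + 6 / 1 * ((C + C) + (ν + ν) * (+ 2 / 3)) - + 8 / 1 * ν
    ≡⟨ solve 2 (λ C ν → con (+ 6 / 1) :* ((C :+ C) :+ (ν :+ ν) :* con (+ 2 / 3)) :- con (+ 8 / 1) :* ν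
                      := con (+ 12 / 1) :* C) refl C ν ⟩
  + 12 / 1 * C ∎)
  where
  open ℚ.≤-Reasoning
  slack≥0 : 0ℚ ≤ + 4 / 1 * ν + + 2 / 1 * D
  slack≥0 = ℚ.+-mono-≤ (ℚ.*-monoˡ-≤-nonNeg (+ 4 / 1) ν≥0) (ℚ.*-monoˡ-≤-nonNeg (+ 2 / 1) D≥0)

does-≟-comm : ∀ a b → does (a ℕ.≟ b) ≡ does (b ℕ.≟ a)
does-≟-comm zero    zero    = refl
does-≟-comm zero    (suc b) = refl
does-≟-comm (suc a) zero    = refl
does-≟-comm (suc a) (suc b) = does-≟-comm a b

module _ (n : ℕ) (c : Fin (n ℕ.+ n) → ℕ) where

  σ : Fin (n ℕ.+ n) → ℚ
  σ u = sign (inV₁ n u)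

  pairCost-sym : ∀ u v → pairCost n c u v ≡ pairCost n c v u
  pairCost-sym u v rewrite does-≟-comm (c u) (c v) | xor-comm (inV₁ n u) (inV₁ n v) = refl

  pairCost-diag : ∀ u → pairCost n c u u ≡ + 2 / 3
  pairCost-diag u rewrite dec-true (c u ℕ.≟ c u) refl | xor-same (inV₁ n u) = refl

  pairCost-linear : ∀ u v →
    + 6 / 1 * pairCost n c u v + σ u * σ v ≡ + 3 / 1 + + 2 / 1 * sameBlock c σ u v
  pairCost-linear u v with does (c u ℕ.≟ c v) | inV₁ n u | inV₁ n v
  ... | true  | true  | true  = refl
  ... | true  | true  | false = refl
  ... | true  | false | true  = refl
  ... | true  | false | false = refl
  ... | false | true  | true  = refl
  ... | false | true  | false = refl
  ... | false | false | true  = refl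
  ... | false | false | false = refl

  cost-identity : + 6 / 1 * ((cost n c + cost n c) + (n ℕ.+ n) × (+ 2 / 3))
                ≡ (n ℕ.+ n) × ((n ℕ.+ n) × (+ 3 / 1)) + + 2 / 1 * ∑∑ (n ℕ.+ n) (sameBlock c σ)
  cost-identity = begin
    + 6 / 1 * ((cost n c + cost n c) + N × (+ 2 / 3))
      ≡⟨ cong₂ (λ t d → + 6 / 1 * ((t + t) + d)) cost≡∑< (sym ∑diag) ⟩
    + 6 / 1 * ((∑< N p + ∑< N p) + ∑[ u < N ] p u u)
      ≡⟨ cong (_*_ (+ 6 / 1)) (sym (∑∑-symmetric-split N p pairCost-sym)) ⟩
    + 6 / 1 * ∑∑ N p
      ≡⟨ sym (ℚ.+-identityʳ _) ⟩
    + 6 / 1 * ∑∑ N p + 0ℚ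
      ≡⟨ cong (λ t → + 6 / 1 * ∑∑ N p + t * t) (sym ∑σ≡0) ⟩
    + 6 / 1 * ∑∑ N p + (∑[ u < N ] σ u) * (∑[ v < N ] σ v)
      ≡⟨ cong₂ _+_ (sym (∑∑-distribˡ-* N (+ 6 / 1) p)) (∑-*-∑ N N σ σ) ⟩
    ∑∑ N (λ u v → + 6 / 1 * p u v) + ∑∑ N (λ u v → σ u * σ v)
      ≡⟨ sym (∑∑-distrib-+ N _ _) ⟩
    ∑∑ N (λ u v → + 6 / 1 * p u v + σ u * σ v)
      ≡⟨ sum-cong-≗ {N} (λ u → sum-cong-≗ {N} (pairCost-linear u)) ⟩
    ∑∑ N (λ u v → + 3 / 1 + + 2 / 1 * sameBlock c σ u v)
      ≡⟨ ∑∑-distrib-+ N _ _ ⟩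
    ∑∑ N (λ _ _ → + 3 / 1) + ∑∑ N (λ u v → + 2 / 1 * sameBlock c σ u v)
      ≡⟨ cong₂ _+_ (∑∑-const N (+ 3 / 1)) (∑∑-distribˡ-* N (+ 2 / 1) (sameBlock c σ)) ⟩
    N × (N × (+ 3 / 1)) + + 2 / 1 * ∑∑ N (sameBlock c σ) ∎
    where
    open ≡-Reasoning
    N : ℕ
    N = n ℕ.+ n
    p : Fin N → Fin N → ℚ
    p = pairCost n c
    cost≡∑< : cost n c ≡ ∑< N p
    cost≡∑< = trans (sumFin≡∑ N _) (sum-cong-≗ {N} (λ u → sumFin≡∑ N _))
    ∑diag : ∑[ u < N ] p u u ≡ N × (+ 2 / 3)
    ∑diag = trans (sum-cong-≗ {N} pairCost-diag) (sum-replicate N)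
    ∑σ≡0 : ∑[ u < N ] σ u ≡ 0ℚ
    ∑σ≡0 = trans (∑-sign n n) (ℚ.+-inverseʳ (n × 1ℚ))

  cost-lower-bound : (n × 1ℚ) * (n × 1ℚ) - n × 1ℚ ≤ cost n c
  cost-lower-bound =
    quadratic-bound (cost n c) ν (∑∑ N (sameBlock c σ)) (×1-nonNeg n) (sameBlock-nonNeg N c σ) (begin
    + 6 / 1 * ((cost n c + cost n c) + (ν + ν) * (+ 2 / 3))
      ≡⟨ cong (λ t → + 6 / 1 * ((cost n c + cost n c) + t)) (N×≡ (+ 2 / 3)) ⟨
    + 6 / 1 * ((cost n c + cost n c) + N × (+ 2 / 3))
      ≡⟨ cost-identity ⟩
    N × (N × (+ 3 / 1)) + + 2 / 1 * ∑∑ N (sameBlock c σ)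
      ≡⟨ cong (λ t → t + + 2 / 1 * ∑∑ N (sameBlock c σ))
              (trans (N×≡ (N × (+ 3 / 1))) (cong (_*_ (ν + ν)) (N×≡ (+ 3 / 1)))) ⟩
    (ν + ν) * ((ν + ν) * (+ 3 / 1)) + + 2 / 1 * ∑∑ N (sameBlock c σ) ∎)
    where
    open ≡-Reasoning
    N : ℕ
    N = n ℕ.+ n
    ν : ℚ
    ν = n × 1ℚ
    N×≡ : ∀ x → N × x ≡ (ν + ν) * x
    N×≡ x = trans (×-as-* N x) (cong (_* x) (×-homo-+ 1ℚ n n))

lemma7 : ∃₂ λ (C n₀ : ℕ) → ∀ (n : ℕ) → n ≥ n₀ → (c : Fin (n Data.Nat.+ n) → ℕ) →
    ((+ (n Data.Nat.* n)) / 1) - ((+ (C Data.Nat.* n)) / 1) ≤ cost n c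
lemma7 = 1 , 0 , λ n _ c → subst (_≤ cost n c) (sym (n²-n≡ n)) (cost-lower-bound n c)
  where
  n²-n≡ : ∀ n → + (n ℕ.* n) / 1 - + (1 ℕ.* n) / 1 ≡ (n × 1ℚ) * (n × 1ℚ) - n × 1ℚ
  n²-n≡ n = cong₂ _-_ (trans (/1≡×1ℚ (n ℕ.* n)) (×1-homo-* n n))
                     (trans (cong (λ k → + k / 1) (ℕ.*-identityˡ n)) (/1≡×1ℚ n))
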